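{- Let $A$ and $B$ be formulas of $S4$ each having property $(**)$, i.e. $\nvdash_{S4} A$, $\vdash_{S4}\diamond A$ and $\vdash_{S4} A\leftrightarrow\Box A$, and likewise $\nvdash_{S4} B$, $\vdash_{S4}\diamond B$, $\vdash_{S4} B\leftrightarrow\Box B$. Then $A\vee B$ has property $(**)$: $\nvdash_{S4} A\vee B$, $\vdash_{S4}\diamond(A\vee B)$ and $\vdash_{S4}(A\vee B)\leftrightarrow\Box(A\vee B)$.
   Context: $S4$ is the normal modal logic with axioms $K:\Box(A\rightarrow B)\rightarrow(\Box A\rightarrow\Box B)$, $T:\Box A\rightarrow A$, $4:\Box A\rightarrow\Box\Box A$ and the necessitation rule; $\diamond A:=\neg\Box\neg A$. $\vdash_{S4}$ denotes provability in $S4$. -}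

module Defs where

open import Data.Nat using (ℕ)

infixr 5 _⇒_
infixr 6 _∨_
infixr 7 _∧_
data Fm : Set where
  var : ℕ → Fm
  ⊥'  : Fm
  _⇒_ : Fm → Fm → Fm
  _∧_ : Fm → Fm → Fm
  _∨_ : Fm → Fm → Fm
  □   : Fm → Fm

¬' : Fm → Fm
¬' A = A ⇒ ⊥'

◇ : Fm → Fm
◇ A = ¬' (□ (¬' A))

infix 4 _⇔_
_⇔_ : Fm → Fm → Fm
A ⇔ B = (A ⇒ B) ∧ (B ⇒ A)

infix 3 ⊢S4_
data ⊢S4_ : Fm → Set where
  ax-K   : ∀ {A B} → ⊢S4 A ⇒ (B ⇒ A)
  ax-S   : ∀ {A B C} → ⊢S4 (A ⇒ (B ⇒ C)) ⇒ ((A ⇒ B) ⇒ (A ⇒ C))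
  ax-∧i  : ∀ {A B} → ⊢S4 A ⇒ (B ⇒ A ∧ B)
  ax-∧e₁ : ∀ {A B} → ⊢S4 A ∧ B ⇒ A
  ax-∧e₂ : ∀ {A B} → ⊢S4 A ∧ B ⇒ B
  ax-∨i₁ : ∀ {A B} → ⊢S4 A ⇒ A ∨ B
  ax-∨i₂ : ∀ {A B} → ⊢S4 B ⇒ A ∨ B
  ax-∨e  : ∀ {A B C} → ⊢S4 (A ⇒ C) ⇒ ((B ⇒ C) ⇒ (A ∨ B ⇒ C))
  ax-DNE : ∀ {A} → ⊢S4 ¬' (¬' A) ⇒ A
  ax-□K  : ∀ {A B} → ⊢S4 □ (A ⇒ B) ⇒ (□ A ⇒ □ B)
  ax-□T  : ∀ {A} → ⊢S4 □ A ⇒ A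
  ax-□4  : ∀ {A} → ⊢S4 □ A ⇒ □ (□ A)
  mp     : ∀ {A B} → ⊢S4 A ⇒ B → ⊢S4 A → ⊢S4 B
  nec    : ∀ {A} → ⊢S4 A → ⊢S4 □ A

module Submission where

-- Write (**) for: ⊬ A, ⊢ ◇A and ⊢ A ⇔ □A.
--  * The two derivable parts are pure Hilbert-calculus reasoning:
--    ◇ is monotone, so ⊢ ◇A gives ⊢ ◇(A ∨ B); and if ⊢ A ⇒ □A and
--    ⊢ B ⇒ □B then ⊢ A ∨ B ⇒ □(A ∨ B), the converse being axiom T.
--  * Unprovability rests on the modal disjunction property of S4:
--    if ⊢ □A ∨ □B then (not not) ⊢ A or ⊢ B.  It is proved with a
--    Kleene-slash style interpretation ⟦_⟧ into Agda types, read
--    classically through double negation, in which ⟦ □ C ⟧ also demands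
--    a derivation of C.  Every theorem of S4 is valid in it, and a valid
--    □A ∨ □B yields a derivation of A or of B.
--  * Since A ⇒ □A and B ⇒ □B, a proof of A ∨ B gives one of □A ∨ □B,
--    hence of A or of B, contradicting ⊬ A and ⊬ B.

open import Defs
open import Data.Product using (_×_; _,_; proj₁; proj₂)
open import Data.Sum using (_⊎_; inj₁; inj₂)
open import Data.Empty using (⊥)
open import Relation.Nullary using (¬_)

⇒-trans : ∀ {X Y Z} → ⊢S4 X ⇒ Y → ⊢S4 Y ⇒ Z → ⊢S4 X ⇒ Z
⇒-trans f g = mp (mp ax-S (mp ax-K g)) f

⇒-compose : ∀ {X Y C} → ⊢S4 (Y ⇒ C) ⇒ ((X ⇒ Y) ⇒ (X ⇒ C))
⇒-compose = ⇒-trans ax-K ax-S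

-- Precomposition with a proved implication X ⇒ Y; with C = ⊥' this is
-- contraposition.
⇒-precompose : ∀ {X Y C} → ⊢S4 X ⇒ Y → ⊢S4 (Y ⇒ C) ⇒ (X ⇒ C)
⇒-precompose f = mp (mp ax-S ⇒-compose) (mp ax-K f)

∨-elim : ∀ {X Y Z} → ⊢S4 X ⇒ Z → ⊢S4 Y ⇒ Z → ⊢S4 X ∨ Y ⇒ Z
∨-elim f g = mp (mp ax-∨e f) g

□-mono : ∀ {X Y} → ⊢S4 X ⇒ Y → ⊢S4 □ X ⇒ □ Y
□-mono f = mp ax-□K (nec f)

◇-mono : ∀ {X Y} → ⊢S4 X ⇒ Y → ⊢S4 ◇ X ⇒ ◇ Y
◇-mono f = ⇒-precompose (□-mono (⇒-precompose f))

∨-□-closed : ∀ {X Y} → ⊢S4 X ⇒ □ X → ⊢S4 Y ⇒ □ Y → ⊢S4 X ∨ Y ⇒ □ (X ∨ Y)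
∨-□-closed x□ y□ = ∨-elim (⇒-trans x□ (□-mono ax-∨i₁)) (⇒-trans y□ (□-mono ax-∨i₂))

∨-□-split : ∀ {X Y} → ⊢S4 X ⇒ □ X → ⊢S4 Y ⇒ □ Y → ⊢S4 X ∨ Y ⇒ □ X ∨ □ Y
∨-□-split x□ y□ = ∨-elim (⇒-trans x□ ax-∨i₁) (⇒-trans y□ ax-∨i₂)

¬¬_ : Set → Set
¬¬ P = ¬ ¬ P

⟦_⟧ : Fm → Set
⟦ var _ ⟧ = ⊥
⟦ ⊥' ⟧ = ⊥
⟦ C ⇒ D ⟧ = ⟦ C ⟧ → ⟦ D ⟧
⟦ C ∧ D ⟧ = ⟦ C ⟧ × ⟦ D ⟧
⟦ C ∨ D ⟧ = ¬¬ (⟦ C ⟧ ⊎ ⟦ D ⟧)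
⟦ □ C ⟧ = ¬¬ ((⊢S4 C) × ⟦ C ⟧)

-- Every interpretation is ¬¬-stable, which validates classical axioms.
⟦⟧-stable : ∀ C → ¬¬ ⟦ C ⟧ → ⟦ C ⟧
⟦⟧-stable (var _) h = h (λ x → x)
⟦⟧-stable ⊥' h = h (λ x → x)
⟦⟧-stable (C ⇒ D) h = λ c → ⟦⟧-stable D (λ ¬d → h (λ f → ¬d (f c)))
⟦⟧-stable (C ∧ D) h =
  ⟦⟧-stable C (λ ¬c → h (λ p → ¬c (proj₁ p))) ,
  ⟦⟧-stable D (λ ¬d → h (λ p → ¬d (proj₂ p)))
⟦⟧-stable (C ∨ D) h = λ ¬cd → h (λ ¬¬cd → ¬¬cd ¬cd)
⟦⟧-stable (□ C) h = λ ¬pc → h (λ ¬¬pc → ¬¬pc ¬pc)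

-- Soundness: every S4 theorem is true in the interpretation.
-- Necessitation is where the derivation itself is stored in ⟦ □ C ⟧.
sound : ∀ {C} → ⊢S4 C → ⟦ C ⟧
sound ax-K = λ a _ → a
sound ax-S = λ f g a → f a (g a)
sound ax-∧i = _,_
sound ax-∧e₁ = proj₁
sound ax-∧e₂ = proj₂
sound ax-∨i₁ = λ a ¬ab → ¬ab (inj₁ a)
sound ax-∨i₂ = λ b ¬ab → ¬ab (inj₂ b)
sound (ax-∨e {C = C}) = λ f g ab → ⟦⟧-stable C λ ¬c →
  ab λ { (inj₁ a) → ¬c (f a) ; (inj₂ b) → ¬c (g b) }
sound (ax-DNE {A}) = ⟦⟧-stable A
sound (ax-□K {A} {B}) = λ □ab □a ¬pb →
  □ab λ { (pab , ab) → □a λ { (pa , a) → ¬pb (mp pab pa , ab a) } }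
sound (ax-□T {A}) = λ □a → ⟦⟧-stable A (λ ¬a → □a (λ pa → ¬a (proj₂ pa)))
sound ax-□4 = λ □a ¬p → □a (λ { (pa , _) → ¬p (nec pa , □a) })
sound (mp f a) = sound f (sound a)
sound (nec p) = λ ¬p → ¬p (p , sound p)

□-disjunction : ∀ {X Y} → ⊢S4 □ X ∨ □ Y → ¬¬ ((⊢S4 X) ⊎ (⊢S4 Y))
□-disjunction p ¬xy = sound p λ
  { (inj₁ □x) → □x (λ px → ¬xy (inj₁ (proj₁ px)))
  ; (inj₂ □y) → □y (λ py → ¬xy (inj₂ (proj₁ py))) }

∨-unprovable : ∀ {X Y} → ⊢S4 X ⇒ □ X → ⊢S4 Y ⇒ □ Y →
               ¬ (⊢S4 X) → ¬ (⊢S4 Y) → ¬ (⊢S4 X ∨ Y)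
∨-unprovable x□ y□ ⊬x ⊬y ⊢xy =
  □-disjunction (mp (∨-□-split x□ y□) ⊢xy)
    λ { (inj₁ ⊢x) → ⊬x ⊢x ; (inj₂ ⊢y) → ⊬y ⊢y }

lemma2p3 : (A B : Fm) →
    (¬ (⊢S4 A)) × (⊢S4 ◇ A) × (⊢S4 A ⇔ □ A) →
    (¬ (⊢S4 B)) × (⊢S4 ◇ B) × (⊢S4 B ⇔ □ B) →
    (¬ (⊢S4 A ∨ B)) × (⊢S4 ◇ (A ∨ B)) × (⊢S4 (A ∨ B) ⇔ □ (A ∨ B))
lemma2p3 A B (⊬A , ⊢◇A , A⇔□A) (⊬B , _ , B⇔□B) =
  ∨-unprovable A⇒□A B⇒□B ⊬A ⊬B ,
  mp (◇-mono ax-∨i₁) ⊢◇A ,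
  mp (mp ax-∧i (∨-□-closed A⇒□A B⇒□B)) ax-□T
  where
  A⇒□A : ⊢S4 A ⇒ □ A
  A⇒□A = mp ax-∧e₁ A⇔□A
  B⇒□B : ⊢S4 B ⇒ □ B
  B⇒□B = mp ax-∧e₁ B⇔□B
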